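{- Let $m$ be a positive integer. Then $L_A((d_5^m)_0)\cong L_B(d_5^m)$ as lattices.
   Context: Let $d_5=\langle(1,2)\rangle\subset\mathbb{F}_5^2$, regard $d_5^m$ blockwise as a subspace of $\mathbb{F}_5^{2m}$, define $\bar{\cdot}:d_5\to\mathbb{F}_5$ by $a(1,2)\mapsto a$, and $(d_5^m)_0=\{(x_i)\in d_5^m:\sum_i\bar x_i=0\}$. Lattices: $A_4=\{x\in\mathbb{Z}^5:\sum x_i=0\}$ with the standard inner product, $\varepsilon_1=e_1-\frac15\sum_je_j$, $A_4^*/A_4=\langle\varepsilon_1+A_4\rangle\cong\mathbb{Z}/5$. For a code $C\subset\mathbb{F}_5^n$, identify $\mathbb{F}_5^n$ with $(A_4^*/A_4)^n$ via $a\mapsto(a_i\varepsilon_1+A_4)_i$; $L_A(C)$ is the preimage of $C$ in $(A_4^*)^n$. With $\rho_\Delta=\frac12\sum_{1\le i<j\le5}(e_i-e_j)$ and $\chi_\Delta=\frac15(\rho_\Delta,\dots,\rho_\Delta)\in\mathbb{R}^{5n}$, $L_B(C)=\{x\in L_A(C):(x,\chi_\Delta)\in\mathbb{Z}\}$. -}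

module Defs where

open import Data.Nat as ℕ using (ℕ; zero; suc)
open import Data.Nat.DivMod using (_mod_)
open import Data.Integer as ℤ using (ℤ; +_; -[1+_])
open import Data.Rational as ℚ using (ℚ; 0ℚ; _/_)
open import Data.Fin as Fin using (Fin; zero; suc; toℕ; combine)
open import Data.Product using (Σ; ∃; _×_)
open import Relation.Binary.PropositionalEquality using (_≡_)

F₅ : Set
F₅ = Fin 5

infixl 6 _+₅_
infixl 7 _*₅_

_+₅_ : F₅ → F₅ → F₅
a +₅ b = (toℕ a ℕ.+ toℕ b) mod 5

_*₅_ : F₅ → F₅ → F₅
a *₅ b = (toℕ a ℕ.* toℕ b) mod 5

∑₅ : ∀ {k} → (Fin k → F₅) → F₅
∑₅ {zero}  f = zero
∑₅ {suc k} f = f zero +₅ ∑₅ (λ i → f (suc i))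

F₅→ℚ : F₅ → ℚ
F₅→ℚ a = (+ toℕ a) / 1

Code : ℕ → Set₁
Code n = (Fin n → F₅) → Set

-- d₅ = ⟨(1,2)⟩ ⊂ F₅², and d₅^m regarded blockwise in F₅^{2m}:
-- coordinate 2i+j (j ∈ {0,1}) is  combine i j  : Fin (m * 2).
-- A codeword is ((a_i·1, a_i·2))_i for a : F₅^m, and ā(x_i) = a_i.
d₅^ : (m : ℕ) → Code (m ℕ.* 2)
d₅^ m c = Σ (Fin m → F₅) λ a →
  ∀ i → (c (combine i zero) ≡ a i *₅ suc zero ×
         c (combine i (suc zero)) ≡ a i *₅ suc (suc zero))

d₅^₀ : (m : ℕ) → Code (m ℕ.* 2)
d₅^₀ m c = Σ (Fin m → F₅) λ a →
  (∀ i → (c (combine i zero) ≡ a i *₅ suc zero ×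
          c (combine i (suc zero)) ≡ a i *₅ suc (suc zero)))
  × ∑₅ a ≡ zero

-- Rational vectors.  ℝ^{5n} is modelled by  Fin n → Fin 5 → ℚ
-- (n blocks of 5 coordinates); all lattices below have rational coordinates.

∑ : ∀ {k} → (Fin k → ℚ) → ℚ
∑ {zero}  f = 0ℚ
∑ {suc k} f = f zero ℚ.+ ∑ (λ i → f (suc i))

Vec5 : ℕ → Set
Vec5 n = Fin n → Fin 5 → ℚ

_⊕_ : ∀ {n} → Vec5 n → Vec5 n → Vec5 n
(x ⊕ y) b i = x b i ℚ.+ y b i

_≈_ : ∀ {n} → Vec5 n → Vec5 n → Set
x ≈ y = ∀ b i → x b i ≡ y b i

⟪_,_⟫ : ∀ {n} → Vec5 n → Vec5 n → ℚ
⟪ x , y ⟫ = ∑ (λ b → ∑ (λ i → x b i ℚ.* y b i))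

IsInt : ℚ → Set
IsInt q = ∃ λ (k : ℤ) → q ≡ k / 1

-- A₄ = { x ∈ ℤ⁵ : Σ xᵢ = 0 },  ε₁ = e₁ − (1/5) Σ eⱼ

InA₄ : (Fin 5 → ℚ) → Set
InA₄ y = (∀ i → IsInt (y i)) × ∑ y ≡ 0ℚ

ε₁ : Fin 5 → ℚ
ε₁ zero    = (+ 4) / 5
ε₁ (suc i) = -[1+ 0 ] / 5

-- L_A(C): preimage of C in (A₄*)ⁿ under (A₄*/A₄)ⁿ ≅ F₅ⁿ, a ↦ (aᵢε₁ + A₄)ᵢ.
-- x lies in it iff there is c ∈ C with xᵦ − c_b ε₁ ∈ A₄ for every block b.
L_A : ∀ {n} → Code n → Vec5 n → Set
L_A {n} C x = Σ (Fin n → F₅) λ c →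
  C c × (∀ b → InA₄ (λ i → x b i ℚ.- F₅→ℚ (c b) ℚ.* ε₁ i))

-- ρ_Δ = ½ Σ_{i<j} (eᵢ − eⱼ) = (2, 1, 0, −1, −2)
ρΔ : Fin 5 → ℚ
ρΔ zero                               = (+ 2) / 1
ρΔ (suc zero)                         = (+ 1) / 1
ρΔ (suc (suc zero))                   = 0ℚ
ρΔ (suc (suc (suc zero)))             = -[1+ 0 ] / 1
ρΔ (suc (suc (suc (suc zero))))       = -[1+ 1 ] / 1

χΔ : ∀ {n} → Vec5 n
χΔ b i = ((+ 1) / 5) ℚ.* ρΔ i

L_B : ∀ {n} → Code n → Vec5 n → Set
L_B C x = L_A C x × IsInt ⟪ x , χΔ ⟫

record LatticeIso {n : ℕ} (L₁ L₂ : Vec5 n → Set) : Set where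
  field
    f       : Vec5 n → Vec5 n
    f-cong  : ∀ x y → x ≈ y → f x ≈ f y
    f-into  : ∀ x → L₁ x → L₂ (f x)
    f-hom   : ∀ x y → L₁ x → L₁ y → f (x ⊕ y) ≈ (f x ⊕ f y)
    f-isom  : ∀ x y → L₁ x → L₁ y → ⟪ f x , f y ⟫ ≡ ⟪ x , y ⟫
    f-inj   : ∀ x y → L₁ x → L₁ y → f x ≈ f y → x ≈ y
    f-onto  : ∀ y → L₂ y → Σ (Vec5 n) λ x → L₁ x × f x ≈ y

module Submission where

-- Λ = L_A(d₅) ⊂ ℚ¹⁰ (a copy of E₈) has an automorphism G, an orthogonal matrix with entries in ⅕ℤ,
-- such that ⟪G u, χ_Δ⟫ ≡ −a/5 (mod ℤ) whenever u + A₄² is the codeword a·(1,2) of d₅.  Applied to each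
-- of the m blocks of ten coordinates, G maps L_A(d₅^m) isometrically onto itself and ⟪G x, χ_Δ⟫ ≡
-- −(Σᵢ aᵢ)/5, which is integral exactly when Σᵢ aᵢ = 0 in F₅; hence G maps L_A((d₅^m)₀) onto L_B(d₅^m).
-- Everything about G reduces to finitely many rational identities, because pairing with a vector whose
-- differences within each block of five are integers is constant modulo ℤ on every coset of A₄².

open import Defs
open import Algebra.Bundles using (Ring)
open import Data.Fin using (Fin; zero; suc; toℕ; fromℕ<; combine; quotient; remainder; _↑ˡ_; _↑ʳ_)
open import Data.Fin.Patterns using (0F; 1F; 2F)
import Data.Fin.Properties as Finₚ
open import Data.Integer as ℤ using (ℤ; +_; -[1+_])
import Data.Integer.DivMod as ℤ
open import Data.Integer.GCD using (gcd)
import Data.Integer.Properties as ℤₚ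
import Data.Integer.Tactic.RingSolver as ℤ-Solver
open import Data.Nat as ℕ using (ℕ; zero; suc; _*_; NonZero)
import Data.Nat.Properties as ℕₚ
open import Data.Product using (Σ; _×_; _,_; proj₁; proj₂)
open import Data.Rational as ℚ using (ℚ; 0ℚ; 1ℚ; _+_; _-_; -_; _/_; mkℚ; toℚᵘ) renaming (_*_ to _·_)
import Data.Rational.Properties as ℚₚ
open import Algebra.Properties.Semiring.Sum (Ring.semiring ℚₚ.+-*-ring)
  using (sum; sum-cong-≗; sum-replicate-zero; ∑-distrib-+; ∑-comm; *-distribˡ-sum; *-distribʳ-sum)
open import Data.Rational.Unnormalised as ℚᵘ using (mkℚᵘ; *≡*)
import Data.Rational.Unnormalised.Properties as ℚᵘₚ
open import Data.Vec using (Vec; []; _∷_; lookup)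
open import Function using (_∘_; _⇔_; mk⇔; Equivalence)
open import Relation.Binary.PropositionalEquality
open import Relation.Nullary using (Dec; yes; no)
open import Relation.Nullary.Decidable using (from-yes; _×-dec_; _→-dec_; dec⇒maybe)
open import Tactic.RingSolver using (solve-∀)
open import Tactic.RingSolver.Core.AlmostCommutativeRing using (AlmostCommutativeRing; fromCommutativeRing)

ℚ-ring : AlmostCommutativeRing _ _
ℚ-ring = fromCommutativeRing ℚₚ.+-*-commutativeRing (λ x → dec⇒maybe (0ℚ ℚₚ.≟ x))

ι : ℤ → ℚ
ι k = k / 1

private
  toℚᵘ-ι : ∀ k → toℚᵘ (ι k) ℚᵘ.≃ mkℚᵘ k 0
  toℚᵘ-ι k = ℚₚ.toℚᵘ-fromℚᵘ (mkℚᵘ k 0)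

ι-+ : ∀ a b → ι (a ℤ.+ b) ≡ ι a + ι b
ι-+ a b = ℚₚ.toℚᵘ-injective (begin
  toℚᵘ (ι (a ℤ.+ b))          ≈⟨ toℚᵘ-ι (a ℤ.+ b) ⟩
  mkℚᵘ (a ℤ.+ b) 0            ≈⟨ *≡* (cross-multiplied a b) ⟩
  mkℚᵘ a 0 ℚᵘ.+ mkℚᵘ b 0      ≈⟨ ℚᵘₚ.+-cong (toℚᵘ-ι a) (toℚᵘ-ι b) ⟨
  toℚᵘ (ι a) ℚᵘ.+ toℚᵘ (ι b)  ≈⟨ ℚₚ.toℚᵘ-homo-+ (ι a) (ι b) ⟨
  toℚᵘ (ι a + ι b)            ∎)
  where
  open ℚᵘₚ.≃-Reasoning
  cross-multiplied : ∀ a b → (a ℤ.+ b) ℤ.* + 1 ≡ (a ℤ.* + 1 ℤ.+ b ℤ.* + 1) ℤ.* + 1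
  cross-multiplied = ℤ-Solver.solve-∀

ι-* : ∀ a b → ι (a ℤ.* b) ≡ ι a · ι b
ι-* a b = ℚₚ.toℚᵘ-injective (begin
  toℚᵘ (ι (a ℤ.* b))          ≈⟨ toℚᵘ-ι (a ℤ.* b) ⟩
  mkℚᵘ a 0 ℚᵘ.* mkℚᵘ b 0      ≈⟨ ℚᵘₚ.*-cong (toℚᵘ-ι a) (toℚᵘ-ι b) ⟨
  toℚᵘ (ι a) ℚᵘ.* toℚᵘ (ι b)  ≈⟨ ℚₚ.toℚᵘ-homo-* (ι a) (ι b) ⟨
  toℚᵘ (ι a · ι b)            ∎)
  where open ℚᵘₚ.≃-Reasoning

ι-neg : ∀ a → ι (ℤ.- a) ≡ - ι a
ι-neg a = ℚₚ.toℚᵘ-injective (begin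
  toℚᵘ (ι (ℤ.- a))   ≈⟨ toℚᵘ-ι (ℤ.- a) ⟩
  ℚᵘ.- mkℚᵘ a 0      ≈⟨ ℚᵘₚ.-‿cong (toℚᵘ-ι a) ⟨
  ℚᵘ.- toℚᵘ (ι a)    ≈⟨ ℚₚ.toℚᵘ-homo‿- (ι a) ⟨
  toℚᵘ (- ι a)       ∎)
  where open ℚᵘₚ.≃-Reasoning

isInt-ι : ∀ k → IsInt (ι k)
isInt-ι k = k , refl

isInt-0 : IsInt 0ℚ
isInt-0 = isInt-ι (+ 0)

isInt-+ : ∀ {p q} → IsInt p → IsInt q → IsInt (p + q)
isInt-+ (i , refl) (j , refl) = i ℤ.+ j , sym (ι-+ i j)

isInt-* : ∀ {p q} → IsInt p → IsInt q → IsInt (p · q)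
isInt-* (i , refl) (j , refl) = i ℤ.* j , sym (ι-* i j)

isInt-neg : ∀ {p} → IsInt p → IsInt (- p)
isInt-neg (i , refl) = ℤ.- i , sym (ι-neg i)

isInt-- : ∀ {p q} → IsInt p → IsInt q → IsInt (p - q)
isInt-- p∈ℤ q∈ℤ = isInt-+ p∈ℤ (isInt-neg q∈ℤ)

isInt-by-difference : ∀ {p q} → IsInt (p - q) → IsInt q → IsInt p
isInt-by-difference {p} {q} p-q∈ℤ q∈ℤ = subst IsInt (sym (split p q)) (isInt-+ p-q∈ℤ q∈ℤ)
  where
  split : ∀ p q → p ≡ (p - q) + q
  split = solve-∀ ℚ-ring

isInt-+-cancelʳ : ∀ {p q} → IsInt (p + q) → IsInt q → IsInt p
isInt-+-cancelʳ {p} {q} p+q∈ℤ q∈ℤ = subst IsInt (cancel p q) (isInt-- p+q∈ℤ q∈ℤ)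
  where
  cancel : ∀ p q → (p + q) - q ≡ p
  cancel = solve-∀ ℚ-ring

isInt-+-cancelˡ : ∀ {p q} → IsInt (p + q) → IsInt p → IsInt q
isInt-+-cancelˡ {p} {q} p+q∈ℤ = isInt-+-cancelʳ (subst IsInt (ℚₚ.+-comm p q) p+q∈ℤ)

isInt-∑ : ∀ {k} {f : Fin k → ℚ} → (∀ i → IsInt (f i)) → IsInt (∑ f)
isInt-∑ {zero}  f∈ℤ = isInt-0
isInt-∑ {suc k} f∈ℤ = isInt-+ (f∈ℤ zero) (isInt-∑ (f∈ℤ ∘ suc))

isInt⇒denominator≡1 : ∀ {q} → IsInt q → ℚ.denominatorℕ q ≡ 1
isInt⇒denominator≡1 (k , refl) =
  ℕₚ.m*n≡1⇒m≡1 _ _ (trans (sym (ℤₚ.abs-* (ℚ.denominator (k / 1)) (gcd k (+ 1))))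
                          (cong ℤ.∣_∣ (ℚₚ.↧-/ k 1)))

isInt? : ∀ q → Dec (IsInt q)
isInt? q@(mkℚ n zero _)    = yes (n , sym (ℚₚ.↥p/↧p≡p q))
isInt? q@(mkℚ n (suc d) _) = no (λ q∈ℤ → ℕₚ.1+n≢0 (ℕₚ.suc-injective (isInt⇒denominator≡1 q∈ℤ)))

∑≡sum : ∀ {k} (f : Fin k → ℚ) → ∑ f ≡ sum f
∑≡sum {zero}  f = refl
∑≡sum {suc k} f = cong (_+_ (f zero)) (∑≡sum (f ∘ suc))

∑-cong : ∀ {k} {f g : Fin k → ℚ} → (∀ i → f i ≡ g i) → ∑ f ≡ ∑ g
∑-cong {f = f} {g} f≗g
  rewrite ∑≡sum f | ∑≡sum g = sum-cong-≗ f≗g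

∑-0 : ∀ k → ∑ {k} (λ _ → 0ℚ) ≡ 0ℚ
∑-0 k = trans (∑≡sum {k} (λ _ → 0ℚ)) (sum-replicate-zero k)

∑-+ : ∀ {k} (f g : Fin k → ℚ) → ∑ (λ i → f i + g i) ≡ ∑ f + ∑ g
∑-+ f g
  rewrite ∑≡sum f | ∑≡sum g | ∑≡sum (λ i → f i + g i) = ∑-distrib-+ f g

∑-*ˡ : ∀ {k} c (f : Fin k → ℚ) → ∑ (λ i → c · f i) ≡ c · ∑ f
∑-*ˡ c f
  rewrite ∑≡sum f | ∑≡sum (λ i → c · f i) = sym (*-distribˡ-sum c f)

∑-*ʳ : ∀ {k} c (f : Fin k → ℚ) → ∑ (λ i → f i · c) ≡ ∑ f · c
∑-*ʳ c f
  rewrite ∑≡sum f | ∑≡sum (λ i → f i · c) = sym (*-distribʳ-sum c f)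

∑-neg : ∀ {k} (f : Fin k → ℚ) → ∑ (λ i → - f i) ≡ - ∑ f
∑-neg {zero}  f = refl
∑-neg {suc k} f = trans (cong (_+_ (- f zero)) (∑-neg (f ∘ suc)))
                        (sym (ℚₚ.neg-distrib-+ (f zero) (∑ (f ∘ suc))))

∑-- : ∀ {k} (f g : Fin k → ℚ) → ∑ (λ i → f i - g i) ≡ ∑ f - ∑ g
∑-- f g = trans (∑-+ f (λ i → - g i)) (cong (_+_ (∑ f)) (∑-neg g))

∑-swap : ∀ {k l} (f : Fin k → Fin l → ℚ) → ∑ (λ i → ∑ (f i)) ≡ ∑ (λ j → ∑ (λ i → f i j))
∑-swap f = begin
  ∑ (λ i → ∑ (f i))               ≡⟨ ∑-cong (λ i → ∑≡sum (f i)) ⟩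
  ∑ (λ i → sum (f i))             ≡⟨ ∑≡sum (λ i → sum (f i)) ⟩
  sum (λ i → sum (f i))           ≡⟨ ∑-comm f ⟩
  sum (λ j → sum (λ i → f i j))   ≡⟨ ∑≡sum (λ j → sum (λ i → f i j)) ⟨
  ∑ (λ j → sum (λ i → f i j))     ≡⟨ ∑-cong (λ j → ∑≡sum (λ i → f i j)) ⟨
  ∑ (λ j → ∑ (λ i → f i j))       ∎
  where open ≡-Reasoning

∑-↑ : ∀ n {k} (h : Fin (n ℕ.+ k) → ℚ) → ∑ h ≡ ∑ (λ i → h (i ↑ˡ k)) + ∑ (λ j → h (n ↑ʳ j))
∑-↑ zero    h = sym (ℚₚ.+-identityˡ (∑ h))
∑-↑ (suc n) h = trans (cong (_+_ (h zero)) (∑-↑ n (h ∘ suc))) (sym (ℚₚ.+-assoc (h zero) _ _))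

∑-combine : ∀ m {n} (h : Fin (m * n) → ℚ) → ∑ h ≡ ∑ (λ i → ∑ (λ j → h (combine {m} {n} i j)))
∑-combine zero    h = refl
∑-combine (suc m) {n} h =
  trans (∑-↑ n h) (cong (_+_ (∑ (λ j → h (j ↑ˡ m * n)))) (∑-combine m (λ b → h (n ↑ʳ b))))

δ : ∀ {k} → Fin k → Fin k → ℚ
δ zero    zero    = 1ℚ
δ zero    (suc _) = 0ℚ
δ (suc _) zero    = 0ℚ
δ (suc b) (suc c) = δ b c

∑-δ : ∀ {k} (b : Fin k) (f : Fin k → ℚ) → ∑ (λ c → δ b c · f c) ≡ f b
∑-δ {suc k} zero f = begin
  1ℚ · f zero + ∑ (λ c → 0ℚ · f (suc c))
    ≡⟨ cong₂ _+_ (ℚₚ.*-identityˡ (f zero)) (∑-*ˡ 0ℚ (f ∘ suc)) ⟩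
  f zero + 0ℚ · ∑ (f ∘ suc)                ≡⟨ cong (_+_ (f zero)) (ℚₚ.*-zeroˡ (∑ (f ∘ suc))) ⟩
  f zero + 0ℚ                              ≡⟨ ℚₚ.+-identityʳ (f zero) ⟩
  f zero                                   ∎
  where open ≡-Reasoning
∑-δ (suc b) f = trans (cong₂ _+_ (ℚₚ.*-zeroˡ (f zero)) (∑-δ b (f ∘ suc))) (ℚₚ.+-identityˡ (f (suc b)))

-- Vectors in ℚ^{5n} and linear maps

infixl 25 _⊖_
infixr 30 _⊛_

_⊖_ : ∀ {n} → Vec5 n → Vec5 n → Vec5 n
(x ⊖ y) b i = x b i - y b i

_⊛_ : ∀ {n} → ℚ → Vec5 n → Vec5 n
(c ⊛ x) b i = c · x b i

_≈?_ : ∀ {n} (x y : Vec5 n) → Dec (x ≈ y)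
x ≈? y = Finₚ.all? λ b → Finₚ.all? λ i → x b i ℚₚ.≟ y b i

BlockConstant : ∀ {n} → Vec5 n → Set
BlockConstant x = ∀ b i → x b i ≡ x b zero

blockConstant? : ∀ {n} (x : Vec5 n) → Dec (BlockConstant x)
blockConstant? x = Finₚ.all? λ b → Finₚ.all? λ i → x b i ℚₚ.≟ x b zero

IntegralDiffs : ∀ {n} → Vec5 n → Set
IntegralDiffs x = ∀ b i → IsInt (x b i - x b zero)

integralDiffs? : ∀ {n} (x : Vec5 n) → Dec (IntegralDiffs x)
integralDiffs? x = Finₚ.all? λ b → Finₚ.all? λ i → isInt? (x b i - x b zero)

∑² : ∀ {n} → Vec5 n → ℚ
∑² x = ∑ (λ b → ∑ (x b))

∑²-cong : ∀ {n} {x y : Vec5 n} → x ≈ y → ∑² x ≡ ∑² y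
∑²-cong x≈y = ∑-cong (λ b → ∑-cong (x≈y b))

∑²-+ : ∀ {n} (x y : Vec5 n) → ∑² (x ⊕ y) ≡ ∑² x + ∑² y
∑²-+ x y = trans (∑-cong (λ b → ∑-+ (x b) (y b))) (∑-+ (∑ ∘ x) (∑ ∘ y))

∑²-- : ∀ {n} (x y : Vec5 n) → ∑² (x ⊖ y) ≡ ∑² x - ∑² y
∑²-- x y = trans (∑-cong (λ b → ∑-- (x b) (y b))) (∑-- (∑ ∘ x) (∑ ∘ y))

∑²-*ˡ : ∀ {n} c (x : Vec5 n) → ∑² (c ⊛ x) ≡ c · ∑² x
∑²-*ˡ c x = trans (∑-cong (λ b → ∑-*ˡ c (x b))) (∑-*ˡ c (∑ ∘ x))

∑²-*ʳ : ∀ {n} c (x : Vec5 n) → ∑² (λ b i → x b i · c) ≡ ∑² x · c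
∑²-*ʳ c x = trans (∑-cong (λ b → ∑-*ʳ c (x b))) (∑-*ʳ c (∑ ∘ x))

∑²-swap : ∀ {n m} (F : Fin n → Fin 5 → Fin m → Fin 5 → ℚ) →
          ∑² (λ b i → ∑² (F b i)) ≡ ∑² (λ c k → ∑² (λ b i → F b i c k))
∑²-swap F = begin
  ∑ (λ b → ∑ (λ i → ∑ (λ c → ∑ (λ k → F b i c k))))
    ≡⟨ ∑-cong (λ b → ∑-swap (λ i c → ∑ (F b i c))) ⟩
  ∑ (λ b → ∑ (λ c → ∑ (λ i → ∑ (λ k → F b i c k))))
    ≡⟨ ∑-cong (λ b → ∑-cong (λ c → ∑-swap (λ i k → F b i c k))) ⟩
  ∑ (λ b → ∑ (λ c → ∑ (λ k → ∑ (λ i → F b i c k))))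
    ≡⟨ ∑-swap (λ b c → ∑ (λ k → ∑ (λ i → F b i c k))) ⟩
  ∑ (λ c → ∑ (λ b → ∑ (λ k → ∑ (λ i → F b i c k))))
    ≡⟨ ∑-cong (λ c → ∑-swap (λ b k → ∑ (λ i → F b i c k))) ⟩
  ∑ (λ c → ∑ (λ k → ∑ (λ b → ∑ (λ i → F b i c k))))
    ∎
  where open ≡-Reasoning

⟪⟫-cong : ∀ {n} {x x′ y y′ : Vec5 n} → x ≈ x′ → y ≈ y′ → ⟪ x , y ⟫ ≡ ⟪ x′ , y′ ⟫
⟪⟫-cong x≈x′ y≈y′ = ∑²-cong (λ b i → cong₂ _·_ (x≈x′ b i) (y≈y′ b i))

⟪⟫-congˡ : ∀ {n} {x x′ : Vec5 n} (y : Vec5 n) → x ≈ x′ → ⟪ x , y ⟫ ≡ ⟪ x′ , y ⟫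
⟪⟫-congˡ y x≈x′ = ⟪⟫-cong {y = y} x≈x′ (λ _ _ → refl)

⟪⟫-congʳ : ∀ {n} (x : Vec5 n) {y y′} → y ≈ y′ → ⟪ x , y ⟫ ≡ ⟪ x , y′ ⟫
⟪⟫-congʳ x y≈y′ = ⟪⟫-cong {x = x} (λ _ _ → refl) y≈y′

⟪⟫-comm : ∀ {n} (x y : Vec5 n) → ⟪ x , y ⟫ ≡ ⟪ y , x ⟫
⟪⟫-comm x y = ∑²-cong (λ b i → ℚₚ.*-comm (x b i) (y b i))

⟪⟫-⊕ˡ : ∀ {n} (x y z : Vec5 n) → ⟪ x ⊕ y , z ⟫ ≡ ⟪ x , z ⟫ + ⟪ y , z ⟫
⟪⟫-⊕ˡ x y z = trans (∑²-cong (λ b i → ℚₚ.*-distribʳ-+ (z b i) (x b i) (y b i)))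
                    (∑²-+ (λ b i → x b i · z b i) (λ b i → y b i · z b i))

⟪⟫-⊖ˡ : ∀ {n} (x y z : Vec5 n) → ⟪ x ⊖ y , z ⟫ ≡ ⟪ x , z ⟫ - ⟪ y , z ⟫
⟪⟫-⊖ˡ x y z = trans (∑²-cong (λ b i → distrib (x b i) (y b i) (z b i)))
                    (∑²-- (λ b i → x b i · z b i) (λ b i → y b i · z b i))
  where
  distrib : ∀ p q r → (p - q) · r ≡ p · r - q · r
  distrib = solve-∀ ℚ-ring

⟪⟫-⊛ˡ : ∀ {n} c (x y : Vec5 n) → ⟪ c ⊛ x , y ⟫ ≡ c · ⟪ x , y ⟫
⟪⟫-⊛ˡ c x y = trans (∑²-cong (λ b i → ℚₚ.*-assoc c (x b i) (y b i)))
                    (∑²-*ˡ c (λ b i → x b i · y b i))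

⟪⟫-⊕ʳ : ∀ {n} (x y z : Vec5 n) → ⟪ x , y ⊕ z ⟫ ≡ ⟪ x , y ⟫ + ⟪ x , z ⟫
⟪⟫-⊕ʳ x y z = trans (⟪⟫-comm x (y ⊕ z))
                    (trans (⟪⟫-⊕ˡ y z x) (cong₂ _+_ (⟪⟫-comm y x) (⟪⟫-comm z x)))

⟪⟫-⊖ʳ : ∀ {n} (x y z : Vec5 n) → ⟪ x , y ⊖ z ⟫ ≡ ⟪ x , y ⟫ - ⟪ x , z ⟫
⟪⟫-⊖ʳ x y z = trans (⟪⟫-comm x (y ⊖ z))
                    (trans (⟪⟫-⊖ˡ y z x) (cong₂ _-_ (⟪⟫-comm y x) (⟪⟫-comm z x)))

⟪⟫-∑ˡ : ∀ {n k} (x : Fin k → Vec5 n) (y : Vec5 n) →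
        ∑ (λ r → ⟪ x r , y ⟫) ≡ ⟪ (λ b i → ∑ (λ r → x r b i)) , y ⟫
⟪⟫-∑ˡ x y = trans (∑-swap (λ r b → ∑ (λ i → x r b i · y b i)))
  (∑-cong (λ b → trans (∑-swap (λ r i → x r b i · y b i))
                       (∑-cong (λ i → ∑-*ʳ (y b i) (λ r → x r b i)))))

⟪⟫-blockConstant : ∀ {n} {x u : Vec5 n} → BlockConstant x → (∀ b → ∑ (u b) ≡ 0ℚ) →
                   ⟪ x , u ⟫ ≡ 0ℚ
⟪⟫-blockConstant {n} {x} {u} x-const ∑u≡0 = begin
  ∑ (λ b → ∑ (λ i → x b i · u b i))
    ≡⟨ ∑-cong (λ b → ∑-cong (λ i → cong (_· u b i) (x-const b i))) ⟩
  ∑ (λ b → ∑ (λ i → x b zero · u b i))   ≡⟨ ∑-cong (λ b → ∑-*ˡ (x b zero) (u b)) ⟩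
  ∑ (λ b → x b zero · ∑ (u b))           ≡⟨ ∑-cong (λ b → cong (x b zero ·_) (∑u≡0 b)) ⟩
  ∑ (λ b → x b zero · 0ℚ)                ≡⟨ ∑-cong (λ b → ℚₚ.*-zeroʳ (x b zero)) ⟩
  ∑ {n} (λ b → 0ℚ)                       ≡⟨ ∑-0 n ⟩
  0ℚ                                     ∎
  where open ≡-Reasoning

Matrix : ℕ → Set
Matrix n = Fin n → Fin 5 → Vec5 n

infixr 30 _⋆_
infixl 30 _⊙_
infix 40 _ᵀ

_⋆_ : ∀ {n} → Matrix n → Vec5 n → Vec5 n
(M ⋆ u) b i = ⟪ M b i , u ⟫

_ᵀ : ∀ {n} → Matrix n → Matrix n
(M ᵀ) b i c k = M c k b i

_⊙_ : ∀ {n} → Matrix n → Matrix n → Matrix n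
(M ⊙ N) b i = N ᵀ ⋆ M b i

𝟙 : ∀ {n} → Matrix n
𝟙 b i c k = δ b c · δ i k

_≈ₘ_ : ∀ {n} → Matrix n → Matrix n → Set
M ≈ₘ N = ∀ b i → M b i ≈ N b i

_≈ₘ?_ : ∀ {n} (M N : Matrix n) → Dec (M ≈ₘ N)
M ≈ₘ? N = Finₚ.all? λ b → Finₚ.all? λ i → M b i ≈? N b i

⋆-cong : ∀ {n} (M : Matrix n) {u v} → u ≈ v → M ⋆ u ≈ M ⋆ v
⋆-cong M u≈v b i = ⟪⟫-congʳ (M b i) u≈v

⋆-congˡ : ∀ {n} {M N : Matrix n} u → M ≈ₘ N → M ⋆ u ≈ N ⋆ u
⋆-congˡ u M≈N b i = ⟪⟫-congˡ u (M≈N b i)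

⋆-⊕ : ∀ {n} (M : Matrix n) u v → M ⋆ (u ⊕ v) ≈ (M ⋆ u ⊕ M ⋆ v)
⋆-⊕ M u v b i = ⟪⟫-⊕ʳ (M b i) u v

⋆-adjoint : ∀ {n} (M : Matrix n) u v → ⟪ M ⋆ u , v ⟫ ≡ ⟪ u , M ᵀ ⋆ v ⟫
⋆-adjoint M u v = begin
  ∑² (λ b i → ∑² (λ c k → M b i c k · u c k) · v b i)
    ≡⟨ ∑²-cong (λ b i → ∑²-*ʳ (v b i) (λ c k → M b i c k · u c k)) ⟨
  ∑² (λ b i → ∑² (λ c k → M b i c k · u c k · v b i))
    ≡⟨ ∑²-swap (λ b i c k → M b i c k · u c k · v b i) ⟩
  ∑² (λ c k → ∑² (λ b i → M b i c k · u c k · v b i))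
    ≡⟨ ∑²-cong (λ c k → ∑²-cong (λ b i → regroup (M b i c k) (u c k) (v b i))) ⟩
  ∑² (λ c k → ∑² (λ b i → u c k · (M b i c k · v b i)))
    ≡⟨ ∑²-cong (λ c k → ∑²-*ˡ (u c k) (λ b i → M b i c k · v b i)) ⟩
  ∑² (λ c k → u c k · ∑² (λ b i → M b i c k · v b i))
    ∎
  where
  open ≡-Reasoning
  regroup : ∀ m p q → m · p · q ≡ p · (m · q)
  regroup = solve-∀ ℚ-ring

⊙-⋆ : ∀ {n} (M N : Matrix n) u → (M ⊙ N) ⋆ u ≈ M ⋆ N ⋆ u
⊙-⋆ M N u b i = ⋆-adjoint (N ᵀ) (M b i) u

𝟙-⋆ : ∀ {n} (u : Vec5 n) → 𝟙 ⋆ u ≈ u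
𝟙-⋆ u b i = begin
  ∑² (λ c k → δ b c · δ i k · u c k)
    ≡⟨ ∑-cong (λ c → trans (∑-cong (λ k → ℚₚ.*-assoc (δ b c) (δ i k) (u c k)))
                           (∑-*ˡ (δ b c) (λ k → δ i k · u c k))) ⟩
  ∑ (λ c → δ b c · ∑ (λ k → δ i k · u c k))  ≡⟨ ∑-cong (λ c → cong (δ b c ·_) (∑-δ i (u c))) ⟩
  ∑ (λ c → δ b c · u c i)                    ≡⟨ ∑-δ b (λ c → u c i) ⟩
  u b i                                      ∎
  where open ≡-Reasoning

⋆-inverse : ∀ {n} {M N : Matrix n} → M ⊙ N ≈ₘ 𝟙 → ∀ u → M ⋆ N ⋆ u ≈ u
⋆-inverse {M = M} {N} MN≈𝟙 u b i =
  trans (sym (⊙-⋆ M N u b i)) (trans (⋆-congˡ u MN≈𝟙 b i) (𝟙-⋆ u b i))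

⋆-isometry : ∀ {n} {M : Matrix n} → M ᵀ ⊙ M ≈ₘ 𝟙 → ∀ u v → ⟪ M ⋆ u , M ⋆ v ⟫ ≡ ⟪ u , v ⟫
⋆-isometry {M = M} MᵀM≈𝟙 u v =
  trans (⋆-adjoint M u (M ⋆ v)) (⟪⟫-congʳ u (⋆-inverse {M = M ᵀ} {M} MᵀM≈𝟙 v))

-- A₄ and its dual

⟪⟫-A₄-isInt : ∀ {n} {x z : Vec5 n} → IntegralDiffs x → (∀ b → InA₄ (z b)) → IsInt ⟪ x , z ⟫
⟪⟫-A₄-isInt {x = x} {z} x-diffs z∈A₄ = subst IsInt (sym ⟪x,z⟫≡⟪x-x₀,z⟫) ⟪x-x₀,z⟫∈ℤ
  where
  open ≡-Reasoning
  x₀ : Vec5 _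
  x₀ b _ = x b zero
  ⟪x-x₀,z⟫∈ℤ : IsInt ⟪ x ⊖ x₀ , z ⟫
  ⟪x-x₀,z⟫∈ℤ = isInt-∑ (λ b → isInt-∑ (λ i → isInt-* (x-diffs b i) (proj₁ (z∈A₄ b) i)))
  split : ∀ p q → p ≡ (p - q) + q
  split = solve-∀ ℚ-ring
  ⟪x₀,z⟫≡0 : ⟪ x₀ , z ⟫ ≡ 0ℚ
  ⟪x₀,z⟫≡0 = ⟪⟫-blockConstant {x = x₀} {z} (λ _ _ → refl) (λ b → proj₂ (z∈A₄ b))
  ⟪x,z⟫≡⟪x-x₀,z⟫ : ⟪ x , z ⟫ ≡ ⟪ x ⊖ x₀ , z ⟫
  ⟪x,z⟫≡⟪x-x₀,z⟫ = begin
    ⟪ x , z ⟫                     ≡⟨ ⟪⟫-congˡ z (λ b i → split (x b i) (x b zero)) ⟩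
    ⟪ x ⊖ x₀ ⊕ x₀ , z ⟫           ≡⟨ ⟪⟫-⊕ˡ (x ⊖ x₀) x₀ z ⟩
    ⟪ x ⊖ x₀ , z ⟫ + ⟪ x₀ , z ⟫   ≡⟨ cong (_+_ ⟪ x ⊖ x₀ , z ⟫) ⟪x₀,z⟫≡0 ⟩
    ⟪ x ⊖ x₀ , z ⟫ + 0ℚ           ≡⟨ ℚₚ.+-identityʳ _ ⟩
    ⟪ x ⊖ x₀ , z ⟫                ∎

fifth : ℚ
fifth = + 1 / 5

five : ℚ
five = ι (+ 5)

two : ℚ
two = ι (+ 2)

frac₅ : F₅ → ℚ
frac₅ a = F₅→ℚ a · fifth

isInt-fifths : ∀ q → IsInt (five · q) → Σ F₅ λ c → IsInt (q + frac₅ c)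
isInt-fifths q (M , 5q≡M) = c , ℤ.- t , q+c/5≡-t
  where
  open ≡-Reasoning
  N = ℤ.- M
  t = N ℤ./ℕ 5
  c : F₅
  c = fromℕ< (ℤ.n%ℕd<d N 5)
  N≡c+5t : ι N ≡ F₅→ℚ c + ι t · five
  N≡c+5t = begin
    ι N                                ≡⟨ cong ι (ℤ.a≡a%ℕn+[a/ℕn]*n N 5) ⟩
    ι (+ (N ℤ.%ℕ 5) ℤ.+ t ℤ.* + 5)     ≡⟨ ι-+ (+ (N ℤ.%ℕ 5)) (t ℤ.* + 5) ⟩
    ι (+ (N ℤ.%ℕ 5)) + ι (t ℤ.* + 5)
      ≡⟨ cong₂ _+_ (cong (ι ∘ +_) (Finₚ.toℕ-fromℕ< (ℤ.n%ℕd<d N 5))) (sym (ι-* t (+ 5))) ⟨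
    F₅→ℚ c + ι t · five                ∎
  regroup : ∀ q C T → q + C · fifth ≡ (five · q + (C + T · five)) · fifth - T
  regroup = solve-∀ ℚ-ring
  cancel : ∀ X T → (X + - X) · fifth - T ≡ - T
  cancel = solve-∀ ℚ-ring
  q+c/5≡-t : q + frac₅ c ≡ ι (ℤ.- t)
  q+c/5≡-t = begin
    q + F₅→ℚ c · fifth
      ≡⟨ regroup q (F₅→ℚ c) (ι t) ⟩
    (five · q + (F₅→ℚ c + ι t · five)) · fifth - ι t
      ≡⟨ cong (λ s → (five · q + s) · fifth - ι t) N≡c+5t ⟨
    (five · q + ι N) · fifth - ι t
      ≡⟨ cong₂ (λ r s → (r + s) · fifth - ι t) 5q≡M (ι-neg M) ⟩
    (ι M + - ι M) · fifth - ι t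
      ≡⟨ cancel (ι M) (ι t) ⟩
    - ι t
      ≡⟨ ι-neg t ⟨
    ι (ℤ.- t)
      ∎

∑ε₁≡0 : ∑ ε₁ ≡ 0ℚ
∑ε₁≡0 = refl

A₄*-coset : ∀ (w : Fin 5 → ℚ) c → IsInt (w zero + frac₅ c) → (∀ k → IsInt (w k - w zero)) → ∑ w ≡ 0ℚ →
            InA₄ (λ k → w k - F₅→ℚ c · ε₁ k)
A₄*-coset w c w₀+c/5∈ℤ diffs∈ℤ ∑w≡0 = entries∈ℤ , ∑≡0
  where
  open ≡-Reasoning
  entry₀ : ∀ w₀ C → w₀ - C · (+ 4 / 5) ≡ (w₀ + C · fifth) - C
  entry₀ = solve-∀ ℚ-ring
  entry : ∀ w₀ w C → w - C · (-[1+ 0 ] / 5) ≡ (w - w₀) + (w₀ + C · fifth)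
  entry = solve-∀ ℚ-ring
  entries∈ℤ : ∀ k → IsInt (w k - F₅→ℚ c · ε₁ k)
  entries∈ℤ zero    = subst IsInt (sym (entry₀ (w zero) (F₅→ℚ c)))
                            (isInt-- w₀+c/5∈ℤ (isInt-ι (+ toℕ c)))
  entries∈ℤ (suc k) = subst IsInt (sym (entry (w zero) (w (suc k)) (F₅→ℚ c)))
                            (isInt-+ (diffs∈ℤ (suc k)) w₀+c/5∈ℤ)
  ∑≡0 : ∑ (λ k → w k - F₅→ℚ c · ε₁ k) ≡ 0ℚ
  ∑≡0 = begin
    ∑ (λ k → w k - F₅→ℚ c · ε₁ k)   ≡⟨ ∑-- w (λ k → F₅→ℚ c · ε₁ k) ⟩
    ∑ w - ∑ (λ k → F₅→ℚ c · ε₁ k)   ≡⟨ cong₂ _-_ ∑w≡0 (∑-*ˡ (F₅→ℚ c) ε₁) ⟩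
    0ℚ - F₅→ℚ c · ∑ ε₁              ≡⟨ cong (λ s → 0ℚ - F₅→ℚ c · s) ∑ε₁≡0 ⟩
    0ℚ - F₅→ℚ c · 0ℚ                ≡⟨ cong (_-_ 0ℚ) (ℚₚ.*-zeroʳ (F₅→ℚ c)) ⟩
    0ℚ                              ∎

A₄*-class : ∀ (w : Fin 5 → ℚ) → (∀ k → IsInt (w k - w zero)) → ∑ w ≡ 0ℚ →
            Σ F₅ λ c → InA₄ (λ k → w k - F₅→ℚ c · ε₁ k)
A₄*-class w diffs∈ℤ ∑w≡0 = c , A₄*-coset w c w₀+c/5∈ℤ diffs∈ℤ ∑w≡0
  where
  -- 5 w₀ = ∑ w − ∑ₖ (w k − w₀), with both sums over Fin 5 written out
  five-times : ∀ a b c d e → five · a ≡ (a + (b + (c + (d + (e + 0ℚ)))))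
                                        - ((a - a) + ((b - a) + ((c - a) + ((d - a) + ((e - a) + 0ℚ)))))
  five-times = solve-∀ ℚ-ring
  5w₀∈ℤ : IsInt (five · w zero)
  5w₀∈ℤ = subst IsInt (sym (five-times (w 0F) (w 1F) (w 2F) (w (suc 2F)) (w (suc (suc 2F)))))
                (isInt-- (subst IsInt (sym ∑w≡0) isInt-0) (isInt-∑ diffs∈ℤ))
  c = proj₁ (isInt-fifths (w zero) 5w₀∈ℤ)
  w₀+c/5∈ℤ = proj₂ (isInt-fifths (w zero) 5w₀∈ℤ)

-- The lattice Λ = L_A(d₅) ⊂ ℚ¹⁰: InΛ a u says that u ∈ Λ and u + A₄² is the codeword a·(1,2) of d₅.

m₅ : Fin 2 → F₅
m₅ 0F = 1F
m₅ 1F = 2F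

γ : F₅ → Vec5 2
γ a j k = F₅→ℚ (a *₅ m₅ j) · ε₁ k

InΛ : F₅ → Vec5 2 → Set
InΛ a u = ∀ j → InA₄ (λ k → u j k - γ a j k)

InΛ-resp-≈ : ∀ {a u v} → u ≈ v → InΛ a u → InΛ a v
InΛ-resp-≈ {a} u≈v u∈Λ j =
  (λ k → subst IsInt (u-γ≡v-γ k) (proj₁ (u∈Λ j) k)) , trans (sym (∑-cong u-γ≡v-γ)) (proj₂ (u∈Λ j))
  where
  u-γ≡v-γ = λ k → cong (_- γ a j k) (u≈v j k)

InΛ⇒∑≡0 : ∀ {a u} → InΛ a u → ∀ j → ∑ (u j) ≡ 0ℚ
InΛ⇒∑≡0 {a} {u} u∈Λ j = begin
  ∑ (u j)                             ≡⟨ split (∑ (u j)) (∑ (γ a j)) ⟩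
  (∑ (u j) - ∑ (γ a j)) + ∑ (γ a j)   ≡⟨ cong₂ _+_ (trans (sym (∑-- (u j) (γ a j))) (proj₂ (u∈Λ j)))
                                                   (∑-*ˡ (F₅→ℚ (a *₅ m₅ j)) ε₁) ⟩
  0ℚ + F₅→ℚ (a *₅ m₅ j) · ∑ ε₁        ≡⟨ cong (λ s → 0ℚ + F₅→ℚ (a *₅ m₅ j) · s) ∑ε₁≡0 ⟩
  0ℚ + F₅→ℚ (a *₅ m₅ j) · 0ℚ          ≡⟨ cong (_+_ 0ℚ) (ℚₚ.*-zeroʳ (F₅→ℚ (a *₅ m₅ j))) ⟩
  0ℚ                                  ∎
  where
  open ≡-Reasoning
  split : ∀ p q → p ≡ (p - q) + q
  split = solve-∀ ℚ-ring

*₅-identityʳ : ∀ a → a *₅ 1F ≡ a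
*₅-identityʳ 0F             = refl
*₅-identityʳ 1F             = refl
*₅-identityʳ 2F             = refl
*₅-identityʳ (suc 2F)       = refl
*₅-identityʳ (suc (suc 2F)) = refl

class-doubling : ∀ c₀ c₁ → IsInt (F₅→ℚ c₁ · ε₁ 0F - two · (F₅→ℚ c₀ · ε₁ 0F)) → c₁ ≡ c₀ *₅ 2F
class-doubling = from-yes (Finₚ.all? λ c₀ → Finₚ.all? λ c₁ →
  isInt? (F₅→ℚ c₁ · ε₁ 0F - two · (F₅→ℚ c₀ · ε₁ 0F)) →-dec (c₁ Finₚ.≟ c₀ *₅ 2F))

inΛ-from-classes : ∀ w c₀ c₁ →
                   InA₄ (λ k → w 0F k - F₅→ℚ c₀ · ε₁ k) → InA₄ (λ k → w 1F k - F₅→ℚ c₁ · ε₁ k) →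
                   IsInt (w 1F 0F - two · w 0F 0F) → InΛ c₀ w
inΛ-from-classes w c₀ c₁ w₀∈c₀ w₁∈c₁ w₁₀-2w₀₀∈ℤ = w∈Λ
  where
  regroup : ∀ W₁ W₀ C₁ C₀ → C₁ · (+ 4 / 5) - two · (C₀ · (+ 4 / 5))
                           ≡ ((W₁ - two · W₀) - (W₁ - C₁ · (+ 4 / 5))) + two · (W₀ - C₀ · (+ 4 / 5))
  regroup = solve-∀ ℚ-ring
  c₁≡2c₀ : c₁ ≡ c₀ *₅ 2F
  c₁≡2c₀ = class-doubling c₀ c₁
    (subst IsInt (sym (regroup (w 1F 0F) (w 0F 0F) (F₅→ℚ c₁) (F₅→ℚ c₀)))
      (isInt-+ (isInt-- w₁₀-2w₀₀∈ℤ (proj₁ w₁∈c₁ 0F)) (isInt-* (isInt-ι (+ 2)) (proj₁ w₀∈c₀ 0F))))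
  w∈Λ : InΛ c₀ w
  w∈Λ 0F = subst (λ c → InA₄ (λ k → w 0F k - F₅→ℚ c · ε₁ k)) (sym (*₅-identityʳ c₀)) w₀∈c₀
  w∈Λ 1F = subst (λ c → InA₄ (λ k → w 1F k - F₅→ℚ c · ε₁ k)) c₁≡2c₀ w₁∈c₁

inΛ-intro : ∀ w → (∀ j → ∑ (w j) ≡ 0ℚ) → IntegralDiffs w → IsInt (w 1F 0F - two · w 0F 0F) →
            Σ F₅ λ a → InΛ a w
inΛ-intro w ∑w≡0 w-diffs w₁₀-2w₀₀∈ℤ =
  c 0F , inΛ-from-classes w (c 0F) (c 1F) (proj₂ (class 0F)) (proj₂ (class 1F)) w₁₀-2w₀₀∈ℤ
  where
  class : ∀ j → Σ F₅ λ c → InA₄ (λ k → w j k - F₅→ℚ c · ε₁ k)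
  class j = A₄*-class (w j) (w-diffs j) (∑w≡0 j)
  c : Fin 2 → F₅
  c j = proj₁ (class j)

⟪⟫-class-invariant : ∀ {x a u} → IntegralDiffs x → InΛ a u → IsInt (⟪ x , u ⟫ - ⟪ x , γ a ⟫)
⟪⟫-class-invariant {x} {a} {u} x-diffs u∈Λ =
  subst IsInt (⟪⟫-⊖ʳ x u (γ a)) (⟪⟫-A₄-isInt {x = x} {z = u ⊖ γ a} x-diffs u∈Λ)

-- Λ is generated by A₄² and the representatives γ a.
IntegralOnΛ : Vec5 2 → Set
IntegralOnΛ x = IntegralDiffs x × (∀ a → IsInt ⟪ x , γ a ⟫)

integralOnΛ? : ∀ x → Dec (IntegralOnΛ x)
integralOnΛ? x = integralDiffs? x ×-dec Finₚ.all? (λ a → isInt? ⟪ x , γ a ⟫)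

⟪⟫-isInt-onΛ : ∀ {x a u} → IntegralOnΛ x → InΛ a u → IsInt ⟪ x , u ⟫
⟪⟫-isInt-onΛ {x} {a} {u} (x-diffs , ⟪x,γ⟫∈ℤ) u∈Λ =
  isInt-by-difference (⟪⟫-class-invariant {x} {a} {u} x-diffs u∈Λ) (⟪x,γ⟫∈ℤ a)

-- Sufficient for M ⋆ Λ ⊆ Λ: the rows of M whose pairings inΛ-intro inspects pair integrally with Λ,
-- and the row sums are constant on blocks, hence orthogonal to A₄².
PreservesΛ : Matrix 2 → Set
PreservesΛ M = (∀ j k → IntegralOnΛ (M j k ⊖ M j 0F))
             × IntegralOnΛ (M 1F 0F ⊖ two ⊛ M 0F 0F)
             × (∀ j → BlockConstant (λ p q → ∑ (λ k → M j k p q)))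

preservesΛ? : ∀ M → Dec (PreservesΛ M)
preservesΛ? M = (Finₚ.all? λ j → Finₚ.all? λ k → integralOnΛ? (M j k ⊖ M j 0F))
          ×-dec integralOnΛ? (M 1F 0F ⊖ two ⊛ M 0F 0F)
          ×-dec (Finₚ.all? λ j → blockConstant? (λ p q → ∑ (λ k → M j k p q)))

⋆-preservesΛ : ∀ {M} → PreservesΛ M → ∀ {a u} → InΛ a u → Σ F₅ λ a′ → InΛ a′ (M ⋆ u)
⋆-preservesΛ {M} (diffs-onΛ , doubling-onΛ , rowSums-const) {a} {u} u∈Λ =
  inΛ-intro (M ⋆ u) ∑Mu≡0 Mu-diffs Mu-doubling
  where
  ∑Mu≡0 : ∀ j → ∑ ((M ⋆ u) j) ≡ 0ℚ
  ∑Mu≡0 j = trans (⟪⟫-∑ˡ (M j) u)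
                  (⟪⟫-blockConstant {x = λ p q → ∑ (λ k → M j k p q)} {u}
                                    (rowSums-const j) (InΛ⇒∑≡0 {a} {u} u∈Λ))
  Mu-diffs : IntegralDiffs (M ⋆ u)
  Mu-diffs j k = subst IsInt (⟪⟫-⊖ˡ (M j k) (M j 0F) u)
                       (⟪⟫-isInt-onΛ {M j k ⊖ M j 0F} {a} {u} (diffs-onΛ j k) u∈Λ)
  Mu-doubling : IsInt ((M ⋆ u) 1F 0F - two · (M ⋆ u) 0F 0F)
  Mu-doubling = subst IsInt (trans (⟪⟫-⊖ˡ (M 1F 0F) (two ⊛ M 0F 0F) u)
                                   (cong (_-_ ⟪ M 1F 0F , u ⟫) (⟪⟫-⊛ˡ two (M 0F 0F) u)))
                      (⟪⟫-isInt-onΛ {M 1F 0F ⊖ two ⊛ M 0F 0F} {a} {u} doubling-onΛ u∈Λ)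

-- The automorphism G.  Row combine j k of 5G lists the entries 5 · G j k p q by column combine p q.
-- Outside this block G is used only through the properties proved in it.
abstract
  5G : Vec (Vec ℤ 10) 10
  5G =
      (+ 0      ∷ -[1+ 0 ] ∷ + 2      ∷ + 1      ∷ + 3      ∷
        + 1      ∷ -[1+ 1 ] ∷ -[1+ 0 ] ∷ + 2      ∷ + 0      ∷ [])
    ∷ (-[1+ 0 ] ∷ + 3      ∷ + 1      ∷ + 0      ∷ + 2      ∷
        -[1+ 0 ] ∷ + 1      ∷ + 2      ∷ + 0      ∷ -[1+ 1 ] ∷ [])
    ∷ (+ 3      ∷ + 2      ∷ + 0      ∷ -[1+ 0 ] ∷ + 1      ∷
        + 2      ∷ -[1+ 0 ] ∷ + 0      ∷ -[1+ 1 ] ∷ + 1      ∷ [])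
    ∷ (+ 2      ∷ + 1      ∷ -[1+ 0 ] ∷ + 3      ∷ + 0      ∷
        + 0      ∷ + 2      ∷ -[1+ 1 ] ∷ + 1      ∷ -[1+ 0 ] ∷ [])
    ∷ (+ 1      ∷ + 0      ∷ + 3      ∷ + 2      ∷ -[1+ 0 ] ∷
        -[1+ 1 ] ∷ + 0      ∷ + 1      ∷ -[1+ 0 ] ∷ + 2      ∷ [])
    ∷ (+ 1      ∷ -[1+ 0 ] ∷ + 0      ∷ -[1+ 1 ] ∷ + 2      ∷
        -[1+ 0 ] ∷ + 3      ∷ + 0      ∷ + 1      ∷ + 2      ∷ [])
    ∷ (+ 0      ∷ -[1+ 1 ] ∷ -[1+ 0 ] ∷ + 2      ∷ + 1      ∷
        + 2      ∷ + 1      ∷ + 3      ∷ -[1+ 0 ] ∷ + 0      ∷ [])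
    ∷ (-[1+ 0 ] ∷ + 2      ∷ -[1+ 1 ] ∷ + 1      ∷ + 0      ∷
        + 0      ∷ -[1+ 0 ] ∷ + 1      ∷ + 2      ∷ + 3      ∷ [])
    ∷ (-[1+ 1 ] ∷ + 1      ∷ + 2      ∷ + 0      ∷ -[1+ 0 ] ∷
        + 3      ∷ + 2      ∷ -[1+ 0 ] ∷ + 0      ∷ + 1      ∷ [])
    ∷ (+ 2      ∷ + 0      ∷ + 1      ∷ -[1+ 0 ] ∷ -[1+ 1 ] ∷
        + 1      ∷ + 0      ∷ + 2      ∷ + 3      ∷ -[1+ 0 ] ∷ [])
    ∷ []

  G : Matrix 2
  G j k p q = lookup (lookup 5G (combine j k)) (combine p q) / 5

  G-orthogonal : G ᵀ ⊙ G ≈ₘ 𝟙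
  G-orthogonal = from-yes (G ᵀ ⊙ G ≈ₘ? 𝟙)

  Gᵀ-orthogonal : G ⊙ G ᵀ ≈ₘ 𝟙
  Gᵀ-orthogonal = from-yes (G ⊙ G ᵀ ≈ₘ? 𝟙)

  G-preservesΛ : PreservesΛ G
  G-preservesΛ = from-yes (preservesΛ? G)

  Gᵀ-preservesΛ : PreservesΛ (G ᵀ)
  Gᵀ-preservesΛ = from-yes (preservesΛ? (G ᵀ))

  Gᵀχ-integralDiffs : IntegralDiffs (G ᵀ ⋆ χΔ)
  Gᵀχ-integralDiffs = from-yes (integralDiffs? (G ᵀ ⋆ χΔ))

  Gᵀχ-classes : ∀ a → IsInt (⟪ G ᵀ ⋆ χΔ , γ a ⟫ + frac₅ a)
  Gᵀχ-classes = from-yes (Finₚ.all? λ a → isInt? (⟪ G ᵀ ⋆ χΔ , γ a ⟫ + frac₅ a))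

G-character : ∀ {a u} → InΛ a u → IsInt (⟪ G ⋆ u , χΔ ⟫ + frac₅ a)
G-character {a} {u} u∈Λ =
  subst IsInt (sym ⟪Gu,χ⟫+a/5≡)
              (isInt-+ (⟪⟫-class-invariant {L} {a} {u} Gᵀχ-integralDiffs u∈Λ) (Gᵀχ-classes a))
  where
  open ≡-Reasoning
  L = G ᵀ ⋆ χΔ
  regroup : ∀ X Y f → X + f ≡ (X - Y) + (Y + f)
  regroup = solve-∀ ℚ-ring
  ⟪Gu,χ⟫+a/5≡ : ⟪ G ⋆ u , χΔ ⟫ + frac₅ a ≡ (⟪ L , u ⟫ - ⟪ L , γ a ⟫) + (⟪ L , γ a ⟫ + frac₅ a)
  ⟪Gu,χ⟫+a/5≡ = begin
    ⟪ G ⋆ u , χΔ ⟫ + frac₅ a                             ≡⟨ cong (_+ frac₅ a) (⋆-adjoint G u χΔ) ⟩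
    ⟪ u , L ⟫ + frac₅ a                                  ≡⟨ cong (_+ frac₅ a) (⟪⟫-comm u L) ⟩
    ⟪ L , u ⟫ + frac₅ a                                  ≡⟨ regroup ⟪ L , u ⟫ ⟪ L , γ a ⟫ (frac₅ a) ⟩
    (⟪ L , u ⟫ - ⟪ L , γ a ⟫) + (⟪ L , γ a ⟫ + frac₅ a)  ∎

frac₅-+ : ∀ a b → IsInt (frac₅ a + frac₅ b - frac₅ (a +₅ b))
frac₅-+ = from-yes (Finₚ.all? λ a → Finₚ.all? λ b → isInt? (frac₅ a + frac₅ b - frac₅ (a +₅ b)))

frac₅-isInt⇒≡0 : ∀ a → IsInt (frac₅ a) → a ≡ 0F
frac₅-isInt⇒≡0 = from-yes (Finₚ.all? λ a → isInt? (frac₅ a) →-dec (a Finₚ.≟ 0F))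

frac₅-∑ : ∀ {k} (a : Fin k → F₅) → IsInt (∑ (frac₅ ∘ a) - frac₅ (∑₅ a))
frac₅-∑ {zero}  a = isInt-0
frac₅-∑ {suc k} a =
  subst IsInt (sym (regroup (frac₅ (a 0F)) (∑ (frac₅ ∘ a ∘ suc)) (frac₅ (∑₅ (a ∘ suc))) (frac₅ (∑₅ a))))
        (isInt-+ (frac₅-∑ (a ∘ suc)) (frac₅-+ (a 0F) (∑₅ (a ∘ suc))))
  where
  regroup : ∀ x S s t → (x + S) - t ≡ (S - s) + (x + s - t)
  regroup = solve-∀ ℚ-ring

isInt-∑frac₅⇔∑₅≡0 : ∀ {k} (a : Fin k → F₅) → IsInt (∑ (frac₅ ∘ a)) ⇔ ∑₅ a ≡ 0F
isInt-∑frac₅⇔∑₅≡0 a = mk⇔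
  (λ ∑∈ℤ → frac₅-isInt⇒≡0 (∑₅ a)
             (isInt-+-cancelˡ (subst IsInt (split (∑ (frac₅ ∘ a)) (frac₅ (∑₅ a))) ∑∈ℤ) (frac₅-∑ a)))
  (λ ∑₅a≡0 → isInt-by-difference (frac₅-∑ a) (subst (IsInt ∘ frac₅) (sym ∑₅a≡0) isInt-0))
  where
  split : ∀ p q → p ≡ (p - q) + q
  split = solve-∀ ℚ-ring

-- Blocks of ten coordinates: coordinate combine i j of ℚ^{5·2m} is coordinate j of block i.

module Blocks (m : ℕ) where

  block : Vec5 (m * 2) → Fin m → Vec5 2
  block x i j = x (combine i j)

  ∀-combine : ∀ {P : Fin (m * 2) → Set} → (∀ (i : Fin m) (j : Fin 2) → P (combine i j)) → ∀ b → P b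
  ∀-combine {P} P-combine b =
    subst P (Finₚ.combine-remQuot {m} 2 b) (P-combine (quotient {m} 2 b) (remainder {m} 2 b))

  ≈-by-blocks : ∀ {x y} → (∀ i → block x i ≈ block y i) → x ≈ y
  ≈-by-blocks {x} {y} x≈y = ∀-combine {λ b → ∀ k → x b k ≡ y b k} x≈y

  ⟪⟫-blocks : ∀ x y → ⟪ x , y ⟫ ≡ ∑ (λ i → ⟪ block x i , block y i ⟫)
  ⟪⟫-blocks x y = ∑-combine m (λ b → ∑ (λ k → x b k · y b k))

  blockwise : Matrix 2 → Vec5 (m * 2) → Vec5 (m * 2)
  blockwise M x b = (M ⋆ block x (quotient {m} 2 b)) (remainder {m} 2 b)

  block-blockwise : ∀ M x i → block (blockwise M x) i ≈ M ⋆ block x i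
  block-blockwise M x i j k = cong (λ (i′ , j′) → (M ⋆ block x i′) j′ k) (Finₚ.remQuot-combine i j)

  blockwise-cong : ∀ M {x y} → x ≈ y → blockwise M x ≈ blockwise M y
  blockwise-cong M x≈y b = ⋆-cong M (λ j → x≈y (combine (quotient {m} 2 b) j)) (remainder {m} 2 b)

  blockwise-⊕ : ∀ M x y → blockwise M (x ⊕ y) ≈ (blockwise M x ⊕ blockwise M y)
  blockwise-⊕ M x y b = ⋆-⊕ M (block x (quotient {m} 2 b)) (block y (quotient {m} 2 b)) (remainder {m} 2 b)

  blockwise-isometry : ∀ {M} → M ᵀ ⊙ M ≈ₘ 𝟙 → ∀ x y → ⟪ blockwise M x , blockwise M y ⟫ ≡ ⟪ x , y ⟫
  blockwise-isometry {M} MᵀM≈𝟙 x y = begin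
    ⟪ blockwise M x , blockwise M y ⟫
      ≡⟨ ⟪⟫-blocks (blockwise M x) (blockwise M y) ⟩
    ∑ (λ i → ⟪ block (blockwise M x) i , block (blockwise M y) i ⟫)
      ≡⟨ ∑-cong (λ i → ⟪⟫-cong (block-blockwise M x i) (block-blockwise M y i)) ⟩
    ∑ (λ i → ⟪ M ⋆ block x i , M ⋆ block y i ⟫)
      ≡⟨ ∑-cong (λ i → ⋆-isometry {M = M} MᵀM≈𝟙 (block x i) (block y i)) ⟩
    ∑ (λ i → ⟪ block x i , block y i ⟫)
      ≡⟨ ⟪⟫-blocks x y ⟨
    ⟪ x , y ⟫
      ∎
    where open ≡-Reasoning

  blockwise-inverse : ∀ {M N} → M ⊙ N ≈ₘ 𝟙 → ∀ x → blockwise M (blockwise N x) ≈ x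
  blockwise-inverse {M} {N} MN≈𝟙 x = ≈-by-blocks λ i j k →
    trans (block-blockwise M (blockwise N x) i j k)
          (trans (⋆-cong M (block-blockwise N x i) j k) (⋆-inverse {M = M} {N} MN≈𝟙 (block x i) j k))

  blockwise-injective : ∀ {M} → M ᵀ ⊙ M ≈ₘ 𝟙 → ∀ {x y} → blockwise M x ≈ blockwise M y → x ≈ y
  blockwise-injective {M} MᵀM≈𝟙 {x} {y} Mx≈My b k =
    trans (sym (blockwise-inverse {M ᵀ} {M} MᵀM≈𝟙 x b k))
          (trans (blockwise-cong (M ᵀ) Mx≈My b k) (blockwise-inverse {M ᵀ} {M} MᵀM≈𝟙 y b k))

  InBlocks : (Fin m → F₅) → Vec5 (m * 2) → Set
  InBlocks a x = ∀ i → InΛ (a i) (block x i)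

  blockwise-preservesΛ : ∀ {M} → PreservesΛ M → ∀ a x → InBlocks a x →
                         Σ (Fin m → F₅) λ a′ → InBlocks a′ (blockwise M x)
  blockwise-preservesΛ {M} M-preservesΛ a x x∈ =
    (λ i → proj₁ (Mx∈ i)) ,
    λ i → InΛ-resp-≈ {proj₁ (Mx∈ i)} {M ⋆ block x i}
                     (λ j k → sym (block-blockwise M x i j k)) (proj₂ (Mx∈ i))
    where
    Mx∈ : ∀ i → Σ F₅ λ a′ → InΛ a′ (M ⋆ block x i)
    Mx∈ i = ⋆-preservesΛ {M} M-preservesΛ {a i} {block x i} (x∈ i)

  blockwise-character : ∀ a x → InBlocks a x → IsInt (⟪ blockwise G x , χΔ ⟫ + ∑ (frac₅ ∘ a))
  blockwise-character a x x∈ =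
    subst IsInt (sym ⟪Gx,χ⟫+∑a/5≡) (isInt-∑ (λ i → G-character {a i} {block x i} (x∈ i)))
    where
    open ≡-Reasoning
    ⟪Gx,χ⟫+∑a/5≡ : ⟪ blockwise G x , χΔ ⟫ + ∑ (frac₅ ∘ a)
                 ≡ ∑ (λ i → ⟪ G ⋆ block x i , χΔ ⟫ + frac₅ (a i))
    ⟪Gx,χ⟫+∑a/5≡ = begin
      ⟪ blockwise G x , χΔ ⟫ + ∑ (frac₅ ∘ a)
        ≡⟨ cong (_+ ∑ (frac₅ ∘ a)) (⟪⟫-blocks (blockwise G x) χΔ) ⟩
      ∑ (λ i → ⟪ block (blockwise G x) i , χΔ ⟫) + ∑ (frac₅ ∘ a)
        ≡⟨ cong (_+ ∑ (frac₅ ∘ a)) (∑-cong (λ i → ⟪⟫-congˡ χΔ (block-blockwise G x i))) ⟩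
      ∑ (λ i → ⟪ G ⋆ block x i , χΔ ⟫) + ∑ (frac₅ ∘ a)
        ≡⟨ ∑-+ (λ i → ⟪ G ⋆ block x i , χΔ ⟫) (frac₅ ∘ a) ⟨
      ∑ (λ i → ⟪ G ⋆ block x i , χΔ ⟫ + frac₅ (a i))
        ∎

  codeword : (Fin m → F₅) → Fin (m * 2) → F₅
  codeword a b = a (quotient {m} 2 b) *₅ m₅ (remainder {m} 2 b)

  codeword-combine : ∀ a i j → codeword a (combine i j) ≡ a i *₅ m₅ j
  codeword-combine a i j = cong (λ (i′ , j′) → a i′ *₅ m₅ j′) (Finₚ.remQuot-combine i j)

  InBlocks⇒cosets : ∀ a x → InBlocks a x → ∀ b → InA₄ (λ k → x b k - F₅→ℚ (codeword a b) · ε₁ k)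
  InBlocks⇒cosets a x x∈ = ∀-combine λ i j →
    subst (λ c → InA₄ (λ k → x (combine i j) k - F₅→ℚ c · ε₁ k)) (sym (codeword-combine a i j)) (x∈ i j)

  cosets⇒InBlocks : ∀ x (c : Fin (m * 2) → F₅) a →
                    (∀ i → c (combine i 0F) ≡ a i *₅ 1F × c (combine i 1F) ≡ a i *₅ 2F) →
                    (∀ b → InA₄ (λ k → x b k - F₅→ℚ (c b) · ε₁ k)) → InBlocks a x
  cosets⇒InBlocks x c a c≡a x-cosets i 0F =
    subst (λ c′ → InA₄ (λ k → x (combine i 0F) k - F₅→ℚ c′ · ε₁ k))
          (proj₁ (c≡a i)) (x-cosets (combine i 0F))
  cosets⇒InBlocks x c a c≡a x-cosets i 1F =
    subst (λ c′ → InA₄ (λ k → x (combine i 1F) k - F₅→ℚ c′ · ε₁ k))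
          (proj₂ (c≡a i)) (x-cosets (combine i 1F))

  InBlocks⇒L_A-d₅^ : ∀ a x → InBlocks a x → L_A (d₅^ m) x
  InBlocks⇒L_A-d₅^ a x x∈ =
    codeword a , (a , λ i → codeword-combine a i 0F , codeword-combine a i 1F) , InBlocks⇒cosets a x x∈

  InBlocks⇒L_A-d₅^₀ : ∀ a x → InBlocks a x → ∑₅ a ≡ 0F → L_A (d₅^₀ m) x
  InBlocks⇒L_A-d₅^₀ a x x∈ ∑₅a≡0 =
    codeword a , (a , (λ i → codeword-combine a i 0F , codeword-combine a i 1F) , ∑₅a≡0) ,
    InBlocks⇒cosets a x x∈

  blockwise-G-into : ∀ x → L_A (d₅^₀ m) x → L_B (d₅^ m) (blockwise G x)
  blockwise-G-into x (c , (a , c≡a , ∑₅a≡0) , x-cosets) =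
    InBlocks⇒L_A-d₅^ a′ (blockwise G x) Gx∈ , ⟪Gx,χ⟫∈ℤ
    where
    x∈ : InBlocks a x
    x∈ = cosets⇒InBlocks x c a c≡a x-cosets
    a′ = proj₁ (blockwise-preservesΛ {G} G-preservesΛ a x x∈)
    Gx∈ = proj₂ (blockwise-preservesΛ {G} G-preservesΛ a x x∈)
    ⟪Gx,χ⟫∈ℤ : IsInt ⟪ blockwise G x , χΔ ⟫
    ⟪Gx,χ⟫∈ℤ = isInt-+-cancelʳ {⟪ blockwise G x , χΔ ⟫} {∑ (frac₅ ∘ a)} (blockwise-character a x x∈)
                               (Equivalence.from (isInt-∑frac₅⇔∑₅≡0 a) ∑₅a≡0)

  blockwise-G-onto : ∀ y → L_B (d₅^ m) y → Σ (Vec5 (m * 2)) λ x → L_A (d₅^₀ m) x × blockwise G x ≈ y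
  blockwise-G-onto y ((c , (a′ , c≡a′) , y-cosets) , ⟪y,χ⟫∈ℤ) =
    x , InBlocks⇒L_A-d₅^₀ a x x∈ ∑₅a≡0 , Gx≈y
    where
    x = blockwise (G ᵀ) y
    y∈ : InBlocks a′ y
    y∈ = cosets⇒InBlocks y c a′ c≡a′ y-cosets
    a = proj₁ (blockwise-preservesΛ {G ᵀ} Gᵀ-preservesΛ a′ y y∈)
    x∈ : InBlocks a x
    x∈ = proj₂ (blockwise-preservesΛ {G ᵀ} Gᵀ-preservesΛ a′ y y∈)
    Gx≈y : blockwise G x ≈ y
    Gx≈y = blockwise-inverse {G} {G ᵀ} Gᵀ-orthogonal y
    ∑₅a≡0 : ∑₅ a ≡ 0F
    ∑₅a≡0 = Equivalence.to (isInt-∑frac₅⇔∑₅≡0 a)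
      (isInt-+-cancelˡ {⟪ blockwise G x , χΔ ⟫} {∑ (frac₅ ∘ a)} (blockwise-character a x x∈)
                       (subst IsInt (sym (⟪⟫-congˡ χΔ Gx≈y)) ⟪y,χ⟫∈ℤ))

lemma4p14 : (m : ℕ) → .{{_ : NonZero m}} →
    LatticeIso {m * 2} (L_A (d₅^₀ m)) (L_B (d₅^ m))
lemma4p14 m = record
  { f      = blockwise G
  ; f-cong = λ _ _ → blockwise-cong G
  ; f-into = blockwise-G-into
  ; f-hom  = λ x y _ _ → blockwise-⊕ G x y
  ; f-isom = λ x y _ _ → blockwise-isometry {G} G-orthogonal x y
  ; f-inj  = λ _ _ _ _ → blockwise-injective {G} G-orthogonal
  ; f-onto = blockwise-G-onto
  }
  where open Blocks m
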